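{- Let $A\subseteq\mathbb{N}$ be a $C_p$-set and let $S$ be a finite subset of $\mathbb{P}$. Let $\tau=\mathbb{N}^{\mathbb{N}}$ be the set of all sequences in $\mathbb{N}$, and let $\mathcal{F}(\tau)$ denote the set of nonempty finite subsets of $\tau$. Then there exist functions $\alpha:\mathcal{F}(\tau)\to\mathbb{N}$ and $H:\mathcal{F}(\tau)\to\{\text{nonempty finite subsets of }\mathbb{N}\}$ such that (1) if $F,G\in\mathcal{F}(\tau)$ and $F\subsetneq G$, then $\max H(F)<\min H(G)$; (2) whenever $n\in\mathbb{N}$, $G_1,\dots,G_n\in\mathcal{F}(\tau)$ with $G_1\subsetneq G_2\subsetneq\cdots\subsetneq G_n$, and $f_i\in G_i$ for $i=1,\dots,n$, one has \[\sum_{i\in\beta}\alpha(G_i)+P\Big(\sum_{i\in\beta}\sum_{t\in H(G_i)}f_i(t)\Big)\in A\] for every nonempty $\beta\subseteq\{1,\dots,n\}$ and every $P\in S$.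
   Context: $\mathbb{P}$ denotes the set of polynomials with integer coefficients which vanish at $0$ and map $\mathbb{N}$ into $\mathbb{N}$. An IP-set is a family $(x_\alpha)_{\alpha}$ indexed by the nonempty finite subsets $\alpha$ of $\mathbb{N}$, obtained from a sequence $(x_n)_{n\in\mathbb{N}}$ in $\mathbb{N}$ by $x_\alpha=\sum_{t\in\alpha}x_t$. A set $A\subseteq\mathbb{N}$ is a $J_p$-set if for every finite $F\subseteq\mathbb{P}$, every $l\in\mathbb{N}$ and all IP-sets $(x^i_\alpha)_\alpha$, $i=1,\dots,l$, there exist $a\in\mathbb{N}\cup\{0\}$ and a nonempty finite $\beta\subseteq\mathbb{N}$ with $a+P(x^i_\beta)\in A$ for all $P\in F$ and $i\in\{1,\dots,l\}$. $\beta\mathbb{N}$ is the space of ultrafilters on $\mathbb{N}$ with the usual extension of addition ($A\in p+q$ iff $\{x:-x+A\in q\}\in p$, where $-x+A=\{y: x+y\in A\}$); $p$ is idempotent if $p+p=p$. $\mathcal{J}_p$ is the set of ultrafilters $p\in\beta\mathbb{N}$ all of whose members are $J_p$-sets. A set $A\subseteq\mathbb{N}$ is a $C_p$-set if $A\in p$ for some idempotent $p\in\mathcal{J}_p$. -}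

module Defs where

open import Data.Nat using (ℕ; zero; suc; _+_; _≤_; _<_)
open import Data.Integer as ℤ using (ℤ)
open import Data.Fin using (Fin; toℕ)
open import Data.List using (List; []; _∷_; map)
open import Data.Nat.ListAction using (sum)
open import Data.List.Membership.Propositional using (_∈_)
open import Data.List.Relation.Unary.Any using (Any)
open import Data.List.Relation.Unary.All using (All)
open import Data.List.Relation.Unary.Unique.Propositional using (Unique)
open import Data.Product using (Σ; _×_)
open import Data.Sum using (_⊎_)
open import Data.Empty using (⊥)
open import Relation.Nullary using (¬_)
open import Relation.Binary.PropositionalEquality using (_≡_; _≢_)

-- Convention: the paper's ℕ = {1,2,3,...}.  Subsets of ℕ are predicates on
-- Agda's ℕ; positivity is imposed explicitly where needed.

Subset : Set₁
Subset = ℕ → Set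

Pos : Subset
Pos n = 1 ≤ n

-- Polynomials in ℙ
-- A coefficient list (c₁ , c₂ , … , c_d) denotes c₁ x + c₂ x² + … + c_d x^d
-- (integer coefficients, vanishing at 0).

evalℤ : List ℤ → ℕ → ℤ
evalℤ []       n = ℤ.+ 0
evalℤ (c ∷ cs) n = ℤ.+ n ℤ.* (c ℤ.+ evalℤ cs n)

record Poly : Set where
  field
    coeffs : List ℤ
    intoℕ  : ∀ n → 1 ≤ n → ℤ.+ 1 ℤ.≤ evalℤ coeffs n

open Poly public

⟦_⟧ : Poly → ℕ → ℕ
⟦ P ⟧ n = ℤ.∣ evalℤ (coeffs P) n ∣

-- Nonempty finite subsets (of ℕ or of Fin n), as duplicate-free nonempty lists

IsNEFin : {X : Set} → List X → Set
IsNEFin β = (β ≢ []) × Unique β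

Σ[_∈_] : (ℕ → ℕ) → List ℕ → ℕ
Σ[ x ∈ β ] = sum (map x β)

IsJp : Subset → Set
IsJp A =
  (F : List Poly) (l : ℕ) (x : Fin l → ℕ → ℕ) →
  (∀ i t → 1 ≤ x i t) →
  Σ ℕ λ a → Σ (List ℕ) λ β → IsNEFin β ×
    (∀ P → P ∈ F → ∀ i → A (a + ⟦ P ⟧ (Σ[ x i ∈ β ])))

-- Ultrafilters on ℕ = {1,2,...} (ultrafilters on Agda's ℕ containing Pos)

record Ultrafilter : Set₁ where
  field
    mem    : Subset → Set
    up     : ∀ {A B : Subset} → (∀ n → A n → B n) → mem A → mem B
    inter  : ∀ {A B : Subset} → mem A → mem B → mem (λ n → A n × B n)
    proper : ¬ mem (λ _ → ⊥)
    ultra  : ∀ (A : Subset) → mem A ⊎ mem (λ n → ¬ A n)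
    onPos  : mem Pos

open Ultrafilter public

-- A ∈ p + q  iff  { x : -x + A ∈ q } ∈ p
_∈⊕_,_ : Subset → Ultrafilter → Ultrafilter → Set
A ∈⊕ p , q = mem p (λ x → mem q (λ y → A (x + y)))

Idempotent : Ultrafilter → Set₁
Idempotent p = ∀ (A : Subset) → (A ∈⊕ p , p → mem p A) × (mem p A → A ∈⊕ p , p)

InJp : Ultrafilter → Set₁
InJp p = ∀ (A : Subset) → mem p A → IsJp A

IsCp : Subset → Set₁
IsCp A = Σ Ultrafilter λ p → Idempotent p × InJp p × mem p A

-- τ = ℕ^ℕ and 𝒻(τ): nonempty finite sets of sequences, as lists,
-- with membership up to pointwise (extensional) equality.
-- Sequence index t of the paper (t ≥ 1) is relabelled as t-1 (order preserving).

Seq : Set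
Seq = ℕ → ℕ

SeqSet : Set
SeqSet = List Seq

_∈ˢ_ : Seq → SeqSet → Set
f ∈ˢ G = Any (λ g → ∀ t → f t ≡ g t) G

_⊆ˢ_ : SeqSet → SeqSet → Set
F ⊆ˢ G = ∀ f → f ∈ˢ F → f ∈ˢ G

_⊊ˢ_ : SeqSet → SeqSet → Set
F ⊊ˢ G = F ⊆ˢ G × Σ Seq λ g → g ∈ˢ G × ¬ (g ∈ˢ F)

Valid : SeqSet → Set
Valid G = (G ≢ []) × All (λ g → ∀ t → 1 ≤ g t) G

-- α : 𝒻(τ) → ℕ and H : 𝒻(τ) → nonempty finite subsets of ℕ, well defined
-- on sets (invariant under extensional equality of the representing lists).
WellDefined : (SeqSet → ℕ) → (SeqSet → List ℕ) → Set
WellDefined α H =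
  (∀ G → Valid G → 1 ≤ α G × IsNEFin (H G)) ×
  (∀ F G → Valid F → Valid G → F ⊆ˢ G → G ⊆ˢ F →
     α F ≡ α G × (∀ t → (t ∈ H F → t ∈ H G) × (t ∈ H G → t ∈ H F)))

Cond1 : (SeqSet → List ℕ) → Set
Cond1 H = ∀ F G → Valid F → Valid G → F ⊊ˢ G →
  ∀ s t → s ∈ H F → t ∈ H G → s < t

Cond2 : Subset → List Poly → (SeqSet → ℕ) → (SeqSet → List ℕ) → Set
Cond2 A S α H =
  ∀ (n : ℕ) (Gs : Fin n → SeqSet) →
  (∀ i → Valid (Gs i)) →
  (∀ i j → toℕ j ≡ suc (toℕ i) → Gs i ⊊ˢ Gs j) →
  (fs : Fin n → Seq) → (∀ i → fs i ∈ˢ Gs i) →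
  (β : List (Fin n)) → IsNEFin β →
  ∀ P → P ∈ S →
    A (sum (map (λ i → α (Gs i)) β)
       + ⟦ P ⟧ (sum (map (λ i → Σ[ fs i ∈ H (Gs i) ]) β)))

-- Fix an idempotent p ∈ 𝒥ₚ with A ∈ p and put A⋆ = {x ∈ A : −x + A ∈ p}; then A⋆ ∈ p and
-- −x + A⋆ ∈ p for x ∈ A⋆.  The values α(F), H(F) are built by recursion on F, keeping every sum
-- of (2) along a chain ending at F inside A⋆.  At F, the finitely many pairs (u, y) of sums along
-- chains below F give C = {z ∈ A⋆ : u + P(y) + z ∈ A⋆ for all such u, y and P ∈ S} ∈ p.  Pick z₀
-- with −z₀ + C ∈ p and apply the J_p-property of −z₀ + C to the IP-sets t ↦ Σ_{s in block t} f(s),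
-- f ∈ F, whose blocks lie above every H(G), G ⊊ F, and to the polynomials P and n ↦ P(y + n) − P(y).
-- These lie in ℙ once y exceeds the point from which P is increasing, which the length of the blocks
-- guarantees.  The witnesses a, β give α(F) = z₀ + a and H(F) = ⋃_{t ∈ β} block t, since
--   u + α(F) + P(y + x) = u + P(y) + z₀ + a + (P(y + x) − P(y)).
-- As F is only a list representing a set of sequences, the values are selected canonically among
-- all candidates satisfying the invariant, so that they depend on the set F alone.

module Submission where

open import Defs

module IntegerPolynomial where

  open import Data.Nat as ℕ using (ℕ; zero; suc)
  import Data.Nat.Properties as ℕ
  open import Data.Integer using (ℤ; +_; -[1+_]; -_; _+_; _-_; _*_; _≤_; _<_; ∣_∣; +≤+; +<+)
  open import Data.Integer.Properties
  open import Data.Integer.Tactic.RingSolver using (solve-∀)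
  open import Data.List using (List; []; _∷_; drop)
  open import Data.Product using (Σ; _,_; proj₁; proj₂)
  open import Data.Empty using (⊥-elim)
  open import Data.Unit using (⊤; tt)
  open import Relation.Nullary using (¬_; yes; no)
  open import Relation.Binary.PropositionalEquality
    using (_≡_; refl; sym; trans; cong; cong₂; subst; subst₂; module ≡-Reasoning)

  horner : List ℤ → ℤ → ℤ
  horner []       x = + 0
  horner (c ∷ cs) x = c + x * horner cs x

  evalℤ≡*horner : ∀ cs n → evalℤ cs n ≡ + n * horner cs (+ n)
  evalℤ≡*horner []       n = sym (*-zeroʳ (+ n))
  evalℤ≡*horner (c ∷ cs) n = cong (λ v → + n * (c + v)) (evalℤ≡*horner cs n)

  _⊕_ : List ℤ → List ℤ → List ℤ
  []       ⊕ ds       = ds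
  (c ∷ cs) ⊕ []       = c ∷ cs
  (c ∷ cs) ⊕ (d ∷ ds) = c + d ∷ cs ⊕ ds

  horner-⊕ : ∀ cs ds x → horner (cs ⊕ ds) x ≡ horner cs x + horner ds x
  horner-⊕ []       ds       x = sym (+-identityˡ _)
  horner-⊕ (c ∷ cs) []       x = sym (+-identityʳ _)
  horner-⊕ (c ∷ cs) (d ∷ ds) x =
    trans (cong (λ v → c + d + x * v) (horner-⊕ cs ds x)) (distribute c d x _ _)
    where
    distribute : ∀ c d x u v → c + d + x * (u + v) ≡ c + x * u + (d + x * v)
    distribute = solve-∀

  scale : ℤ → List ℤ → List ℤ
  scale k []       = []
  scale k (c ∷ cs) = k * c ∷ scale k cs

  horner-scale : ∀ k cs x → horner (scale k cs) x ≡ k * horner cs x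
  horner-scale k []       x = sym (*-zeroʳ k)
  horner-scale k (c ∷ cs) x =
    trans (cong (λ v → k * c + x * v) (horner-scale k cs x)) (distribute k c x _)
    where
    distribute : ∀ k c x u → k * c + x * (k * u) ≡ k * (c + x * u)
    distribute = solve-∀

  translate : List ℤ → ℤ → List ℤ
  translate []       y = []
  translate (c ∷ cs) y = (c ∷ []) ⊕ (scale y ts ⊕ (+ 0 ∷ ts))
    where
    ts : List ℤ
    ts = translate cs y

  horner-translate : ∀ cs y x → horner (translate cs y) x ≡ horner cs (y + x)
  horner-translate []       y x = refl
  horner-translate (c ∷ cs) y x = begin
    horner ((c ∷ []) ⊕ (scale y ts ⊕ (+ 0 ∷ ts))) x
      ≡⟨ horner-⊕ (c ∷ []) (scale y ts ⊕ (+ 0 ∷ ts)) x ⟩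
    horner (c ∷ []) x + horner (scale y ts ⊕ (+ 0 ∷ ts)) x
      ≡⟨ cong (λ v → horner (c ∷ []) x + v) (horner-⊕ (scale y ts) (+ 0 ∷ ts) x) ⟩
    horner (c ∷ []) x + (horner (scale y ts) x + horner (+ 0 ∷ ts) x)
      ≡⟨ cong (λ v → horner (c ∷ []) x + (v + horner (+ 0 ∷ ts) x)) (horner-scale y ts x) ⟩
    horner (c ∷ []) x + (y * horner ts x + (+ 0 + x * horner ts x))
      ≡⟨ cong (λ v → horner (c ∷ []) x + (y * v + (+ 0 + x * v))) (horner-translate cs y x) ⟩
    c + x * + 0 + (y * horner cs (y + x) + (+ 0 + x * horner cs (y + x)))
      ≡⟨ collect c x y _ ⟩
    c + (y + x) * horner cs (y + x) ∎
    where
    open ≡-Reasoning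
    ts : List ℤ
    ts = translate cs y
    collect : ∀ c x y u → c + x * + 0 + (y * u + (+ 0 + x * u)) ≡ c + (y + x) * u
    collect = solve-∀

  -- Coefficients of n ↦ P (y + n) − P y, read off from P (y + x) by dropping its constant term.
  increment : List ℤ → ℕ → List ℤ
  increment cs y = drop 1 (translate (+ 0 ∷ cs) (+ y))

  evalℤ-drop₁ : ∀ ds n → evalℤ (drop 1 ds) n ≡ horner ds (+ n) - horner ds (+ 0)
  evalℤ-drop₁ []       n = refl
  evalℤ-drop₁ (d ∷ ds) n = trans (evalℤ≡*horner ds n) (cancel d (+ n) (horner ds (+ n)) (horner ds (+ 0)))
    where
    cancel : ∀ d n u v → n * u ≡ d + n * u - (d + + 0 * v)
    cancel = solve-∀

  horner-0∷ : ∀ cs n → horner (+ 0 ∷ cs) (+ n) ≡ evalℤ cs n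
  horner-0∷ cs n = trans (+-identityˡ _) (sym (evalℤ≡*horner cs n))

  evalℤ-increment : ∀ cs y n → evalℤ (increment cs y) n ≡ evalℤ cs (y ℕ.+ n) - evalℤ cs y
  evalℤ-increment cs y n = begin
    evalℤ (increment cs y) n
      ≡⟨ evalℤ-drop₁ (translate (+ 0 ∷ cs) (+ y)) n ⟩
    horner (translate (+ 0 ∷ cs) (+ y)) (+ n) - horner (translate (+ 0 ∷ cs) (+ y)) (+ 0)
      ≡⟨ cong₂ _-_ (horner-translate (+ 0 ∷ cs) (+ y) (+ n)) (horner-translate (+ 0 ∷ cs) (+ y) (+ 0)) ⟩
    horner (+ 0 ∷ cs) (+ y + + n) - horner (+ 0 ∷ cs) (+ y + + 0)
      ≡⟨ cong₂ _-_ (horner-0∷ cs (y ℕ.+ n)) (trans (cong (horner (+ 0 ∷ cs)) (+-identityʳ (+ y))) (horner-0∷ cs y)) ⟩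
    evalℤ cs (y ℕ.+ n) - evalℤ cs y ∎
    where open ≡-Reasoning

  Increasing≥ : ℕ → (ℕ → ℤ) → Set
  Increasing≥ Z f = ∀ z → Z ℕ.≤ z → f z < f (suc z)

  EventuallyIncreasing : (ℕ → ℤ) → Set
  EventuallyIncreasing f = Σ ℕ λ Z → Increasing≥ Z f

  EventuallyEqual : (ℕ → ℤ) → ℤ → Set
  EventuallyEqual f k = Σ ℕ λ Z → ∀ z → Z ℕ.≤ z → f z ≡ k

  -- Limit constrains the eventual value in the constant case: for z ↦ z · g z it can only be 0,
  -- so a polynomial vanishing at 0 that is positive on ℕ⁺ cannot be eventually constant.
  data Trend (f : ℕ → ℤ) (Limit : ℤ → Set) : Set where
    increasing : EventuallyIncreasing f → Trend f Limit
    decreasing : EventuallyIncreasing (λ z → - f z) → Trend f Limit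
    constant   : ∀ {k} → Limit k → EventuallyEqual f k → Trend f Limit

  increasing-grows : ∀ {Z f y} → Increasing≥ Z f → Z ℕ.≤ y → ∀ d → f y + + d ≤ f (d ℕ.+ y)
  increasing-grows {f = f} {y} inc Z≤y zero    = ≤-reflexive (+-identityʳ (f y))
  increasing-grows {f = f} {y} inc Z≤y (suc d) = begin
    f y + + suc d       ≡⟨ shuffle (f y) (+ d) ⟩
    + 1 + (f y + + d)   ≤⟨ +-monoʳ-≤ (+ 1) (increasing-grows inc Z≤y d) ⟩
    + 1 + f (d ℕ.+ y)   ≤⟨ i<j⇒suc[i]≤j (inc (d ℕ.+ y) (ℕ.≤-trans Z≤y (ℕ.m≤n+m y d))) ⟩
    f (suc d ℕ.+ y)     ∎
    where
    open ≤-Reasoning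
    shuffle : ∀ a b → a + (+ 1 + b) ≡ + 1 + (a + b)
    shuffle = solve-∀

  increasing⇒strictlyAbove : ∀ {Z f y} → Increasing≥ Z f → Z ℕ.≤ y → ∀ d → f y < f (suc d ℕ.+ y)
  increasing⇒strictlyAbove {f = f} {y} inc Z≤y d =
    <-≤-trans (i<i+1+n (f y) d) (increasing-grows inc Z≤y (suc d))
    where
    i<i+1+n : ∀ i n → i < i + + suc n
    i<i+1+n i n = subst (_< i + + suc n) (+-identityʳ i) (+-monoʳ-< i (+<+ (ℕ.s≤s ℕ.z≤n)))

  increasing⇒eventuallyNonNeg : ∀ {f} → EventuallyIncreasing f → Σ ℕ λ N → ∀ z → N ℕ.≤ z → + 0 ≤ f z
  increasing⇒eventuallyNonNeg {f} (Z , inc) = ∣ f Z ∣ ℕ.+ Z , nonNeg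
    where
    nonNeg : ∀ z → ∣ f Z ∣ ℕ.+ Z ℕ.≤ z → + 0 ≤ f z
    nonNeg z N≤z = subst (λ w → + 0 ≤ f w) (ℕ.m∸n+n≡m Z≤z) (begin
      + 0                       ≤⟨ i+∣i∣≥0 (f Z) ⟩
      f Z + + ∣ f Z ∣           ≤⟨ +-monoʳ-≤ (f Z) (+≤+ (ℕ.m+n≤o⇒m≤o∸n ∣ f Z ∣ N≤z)) ⟩
      f Z + + (z ℕ.∸ Z)         ≤⟨ increasing-grows inc ℕ.≤-refl (z ℕ.∸ Z) ⟩
      f ((z ℕ.∸ Z) ℕ.+ Z)       ∎)
      where
      open ≤-Reasoning
      Z≤z : Z ℕ.≤ z
      Z≤z = ℕ.m+n≤o⇒n≤o ∣ f Z ∣ N≤z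
      i+∣i∣≥0 : ∀ i → + 0 ≤ i + + ∣ i ∣
      i+∣i∣≥0 (+ n)      = +≤+ ℕ.z≤n
      i+∣i∣≥0 -[1+ n ]  = ≤-reflexive (sym (+-inverseˡ (+ suc n)))

  increasing-cong : ∀ {f h} → (∀ z → f z ≡ h z) → EventuallyIncreasing f → EventuallyIncreasing h
  increasing-cong f≡h (Z , inc) = Z , λ z Z≤z → subst₂ _<_ (f≡h z) (f≡h (suc z)) (inc z Z≤z)

  +-trend : ∀ c {f Limit} → Trend f Limit → Trend (λ z → c + f z) (λ _ → ⊤)
  +-trend c (increasing (Z , inc)) = increasing (Z , λ z Z≤z → +-monoʳ-< c (inc z Z≤z))
  +-trend c (decreasing (Z , inc)) =
    decreasing (increasing-cong (λ z → sym (neg-distrib-+ c _)) (Z , λ z Z≤z → +-monoʳ-< (- c) (inc z Z≤z)))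
  +-trend c (constant _ (Z , eq)) = constant tt (Z , λ z Z≤z → cong (λ v → c + v) (eq z Z≤z))

  *-step : ∀ z {a b} → a ≤ b → + 0 < b → + z * a < + suc z * b
  *-step z {a} {b} a≤b 0<b = begin-strict
    + z * a          ≤⟨ *-monoˡ-≤-nonNeg (+ z) a≤b ⟩
    + z * b          ≡⟨ sym (+-identityʳ _) ⟩
    + z * b + + 0    <⟨ +-monoʳ-< (+ z * b) 0<b ⟩
    + z * b + b      ≡⟨ collect (+ z) b ⟩
    + suc z * b      ∎
    where
    open ≤-Reasoning
    collect : ∀ x b → x * b + b ≡ (+ 1 + x) * b
    collect = solve-∀

  *-increasing : ∀ {g} → EventuallyIncreasing g → EventuallyIncreasing (λ z → + z * g z)
  *-increasing {g} (Z , inc) with increasing⇒eventuallyNonNeg (Z , inc)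
  ... | N , nonNeg = N ℕ.⊔ Z , λ z N⊔Z≤z →
    let Z≤z = ℕ.m⊔n≤o⇒n≤o N Z N⊔Z≤z
    in *-step z (<⇒≤ (inc z Z≤z)) (≤-<-trans (nonNeg z (ℕ.m⊔n≤o⇒m≤o N Z N⊔Z≤z)) (inc z Z≤z))

  *-positiveConstant : ∀ {g k} → + 0 < k → EventuallyEqual g k → EventuallyIncreasing (λ z → + z * g z)
  *-positiveConstant {g} 0<k (Z , eq) = Z , λ z Z≤z →
    subst₂ _<_ (cong (+ z *_) (sym (eq z Z≤z))) (cong (+ suc z *_) (sym (eq (suc z) (ℕ.m≤n⇒m≤1+n Z≤z))))
      (*-step z ≤-refl 0<k)

  *-trend : ∀ {g Limit} → Trend g Limit → Trend (λ z → + z * g z) (_≡ + 0)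
  *-trend (increasing inc) = increasing (*-increasing inc)
  *-trend (decreasing inc) =
    decreasing (increasing-cong (λ z → sym (neg-distribʳ-* (+ z) _)) (*-increasing inc))
  *-trend (constant {+ zero} _ (Z , eq)) =
    constant refl (Z , λ z Z≤z → trans (cong (+ z *_) (eq z Z≤z)) (*-zeroʳ (+ z)))
  *-trend (constant {+ suc m} _ g≡k) = increasing (*-positiveConstant (+<+ (ℕ.s≤s ℕ.z≤n)) g≡k)
  *-trend (constant { -[1+ m ]} _ (Z , eq)) =
    decreasing (increasing-cong (λ z → sym (neg-distribʳ-* (+ z) _))
                 (*-positiveConstant (+<+ (ℕ.s≤s ℕ.z≤n)) (Z , λ z Z≤z → cong -_ (eq z Z≤z))))

  evalℤ-trend : ∀ cs → Trend (evalℤ cs) (_≡ + 0)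
  evalℤ-trend []       = constant refl (0 , λ _ _ → refl)
  evalℤ-trend (c ∷ cs) = *-trend (+-trend c (evalℤ-trend cs))

  positive⇒increasing : ∀ cs → (∀ n → 1 ℕ.≤ n → + 1 ≤ evalℤ cs n) → EventuallyIncreasing (evalℤ cs)
  positive⇒increasing cs pos with evalℤ-trend cs
  ... | increasing inc = inc
  ... | constant refl (Z , eq)
    with +≤+ () ← subst (+ 1 ≤_) (eq (suc Z) (ℕ.n≤1+n Z)) (pos (suc Z) (ℕ.s≤s ℕ.z≤n))
  ... | decreasing inc with increasing⇒eventuallyNonNeg inc
  ... | N , nonNeg = ⊥-elim (0≰-1 (≤-trans (nonNeg (suc N) (ℕ.n≤1+n N)) (neg-mono-≤ (pos (suc N) (ℕ.s≤s ℕ.z≤n)))))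
    where
    0≰-1 : ¬ (+ 0 ≤ -[1+ 0 ])
    0≰-1 ()

  threshold : Poly → ℕ
  threshold P = proj₁ (positive⇒increasing (coeffs P) (intoℕ P))

  evalℤ-increasingFrom : ∀ P {y} → threshold P ℕ.≤ y → ∀ d →
                         evalℤ (coeffs P) y < evalℤ (coeffs P) (y ℕ.+ suc d)
  evalℤ-increasingFrom P {y} t≤y d =
    subst (λ w → evalℤ (coeffs P) y < evalℤ (coeffs P) w) (ℕ.+-comm (suc d) y)
      (increasing⇒strictlyAbove (proj₂ (positive⇒increasing (coeffs P) (intoℕ P))) t≤y d)

  incrementPoly≥ : (P : Poly) (y : ℕ) → threshold P ℕ.≤ y → Poly
  incrementPoly≥ P y t≤y = record { coeffs = increment (coeffs P) y ; intoℕ = positive }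
    where
    positive : ∀ n → 1 ℕ.≤ n → + 1 ≤ evalℤ (increment (coeffs P) y) n
    positive (suc d) _ = begin
      + 1                                                        ≡⟨ sym (1+i-i (evalℤ (coeffs P) y)) ⟩
      + 1 + evalℤ (coeffs P) y - evalℤ (coeffs P) y               ≤⟨ +-monoˡ-≤ _ (i<j⇒suc[i]≤j (evalℤ-increasingFrom P t≤y d)) ⟩
      evalℤ (coeffs P) (y ℕ.+ suc d) - evalℤ (coeffs P) y         ≡⟨ sym (evalℤ-increment (coeffs P) y (suc d)) ⟩
      evalℤ (increment (coeffs P) y) (suc d)                      ∎
      where
      open ≤-Reasoning
      1+i-i : ∀ i → + 1 + i - i ≡ + 1
      1+i-i = solve-∀

  -- For y below the threshold the value is irrelevant; P itself is returned.
  incrementPoly : Poly → ℕ → Poly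
  incrementPoly P y with threshold P ℕ.≤? y
  ... | yes t≤y = incrementPoly≥ P y t≤y
  ... | no  _   = P

  ∣j-i∣+∣i∣≡∣j∣ : ∀ {i j} → + 0 ≤ i → i ≤ j → ∣ j - i ∣ ℕ.+ ∣ i ∣ ≡ ∣ j ∣
  ∣j-i∣+∣i∣≡∣j∣ {i} {j} 0≤i i≤j = +-injective (begin
    + (∣ j - i ∣ ℕ.+ ∣ i ∣)   ≡⟨ pos-+ ∣ j - i ∣ ∣ i ∣ ⟩
    + ∣ j - i ∣ + + ∣ i ∣     ≡⟨ cong₂ _+_ (0≤i⇒+∣i∣≡i (i≤j⇒0≤j-i i≤j)) (0≤i⇒+∣i∣≡i 0≤i) ⟩
    j - i + i                 ≡⟨ j-i+i j i ⟩
    j                         ≡⟨ sym (0≤i⇒+∣i∣≡i (≤-trans 0≤i i≤j)) ⟩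
    + ∣ j ∣                   ∎)
    where
    open ≡-Reasoning
    j-i+i : ∀ j i → j - i + i ≡ j
    j-i+i = solve-∀

  ⟦incrementPoly⟧ : ∀ P {y} → threshold P ℕ.≤ y → 1 ℕ.≤ y → ∀ n →
                    ⟦ incrementPoly P y ⟧ n ℕ.+ ⟦ P ⟧ y ≡ ⟦ P ⟧ (y ℕ.+ n)
  ⟦incrementPoly⟧ P {y} t≤y 1≤y n with threshold P ℕ.≤? y
  ... | no t≰y = ⊥-elim (t≰y t≤y)
  ... | yes _  = trans (cong (λ v → ∣ v ∣ ℕ.+ ⟦ P ⟧ y) (evalℤ-increment (coeffs P) y n))
                       (∣j-i∣+∣i∣≡∣j∣ (≤-trans (+≤+ ℕ.z≤n) (intoℕ P y 1≤y)) (P-mono n))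
    where
    P-mono : ∀ n → evalℤ (coeffs P) y ≤ evalℤ (coeffs P) (y ℕ.+ n)
    P-mono zero    = ≤-reflexive (cong (evalℤ (coeffs P)) (sym (ℕ.+-identityʳ y)))
    P-mono (suc d) = <⇒≤ (evalℤ-increasingFrom P t≤y d)

open IntegerPolynomial using (threshold; incrementPoly; ⟦incrementPoly⟧)
open import Data.Nat using (ℕ; _≤_)
open import Data.List using (List)
open import Data.Product using (Σ; _×_)

open import Data.Nat.Base using (zero; suc; _+_; _*_; _<_; _∸_; _⊔_; z≤n; s≤s; NonZero; >-nonZero⁻¹)
open import Data.Nat.Properties
open import Data.Nat.ListAction using (sum)
open import Data.Nat.Tactic.RingSolver using (solve-∀)
open import Algebra.Properties.CommutativeSemigroup +-commutativeSemigroup using () renaming (interchange to +-interchange)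
open import Data.Nat.ListAction.Properties using (sum-↭; sum-++)
open import Data.Nat.DivMod using (_/_; +-distrib-/-∣ˡ; m*n/n≡m; m<n⇒m/n≡0)
open import Data.Nat.Divisibility using (divides-refl)
open import Data.List.Base
  using ([]; _∷_; map; filter; length; lookup; _++_; concatMap; downFrom; cartesianProduct)
open import Data.List.Membership.DecPropositional _≟_ using () renaming (_∈?_ to _∈ℕ?_)
open import Data.Fin.Base as Fin using (Fin; toℕ; fromℕ<)
open import Data.Fin.Properties using (toℕ<n; toℕ-fromℕ<; toℕ-injective) renaming (_≟_ to _≟ᶠ_)
import Data.Integer.Base as ℤ
open import Data.List.Properties
  using (map-cong-local; filter-notAll; length-map; length-++; length-downFrom; map-++)
open import Data.List.Extrema.Nat using (max; xs≤max; argmax; argmax-sel; f[⊥]≤f[argmax]; f[xs]≤f[argmax])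
open import Data.List.Membership.Propositional using (_∈_; find; lose)
open import Data.List.Membership.Propositional.Properties
  using (∈-filter⁺; ∈-filter⁻; ∈-map⁺; ∈-map⁻; ∈-concatMap⁺; ∈-concatMap⁻; ∈-++⁺ˡ; ∈-++⁺ʳ; ∈-lookup; ∈-downFrom⁺; ∈-downFrom⁻;
         ∈-cartesianProduct⁺)
open import Data.List.Relation.Unary.Any as Any using (Any; here; there)
open import Data.List.Relation.Unary.Any.Properties using (lookup-index)
open import Data.List.Relation.Unary.All as All using (All; []; _∷_)
import Data.List.Relation.Unary.All.Properties as AllP
open import Data.List.Relation.Unary.AllPairs using ([]; _∷_)
open import Data.List.Relation.Unary.Unique.Propositional using (Unique)
import Data.List.Relation.Unary.Unique.Propositional.Properties as Unique
open import Data.List.Relation.Binary.BagAndSetEquality using (_∼[_]_; set; ∼bag⇒↭)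
open import Data.List.Membership.Propositional.Properties.WithK using (unique∧set⇒bag)
open import Data.List.Relation.Binary.Permutation.Propositional.Properties using (↭-length)
import Data.List.Relation.Binary.Permutation.Propositional.Properties as ↭
open import Data.Product using (_,_; proj₁; proj₂)
open import Data.Sum using (_⊎_; inj₁; inj₂)
open import Function.Bundles using (_⇔_; mk⇔; Equivalence)
open import Relation.Nullary using (¬_; Dec; yes; no; ¬?; contradiction)
open import Relation.Binary.Definitions using (DecidableEquality; tri<; tri≈; tri>)
open import Relation.Binary.PropositionalEquality
  using (_≡_; _≢_; refl; sym; trans; cong; cong₂; subst; subst₂; module ≡-Reasoning)

module _ {X : Set} where

  sum-map-cong : {g h : X → ℕ} (xs : List X) → (∀ {x} → x ∈ xs → g x ≡ h x) →
                 sum (map g xs) ≡ sum (map h xs)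
  sum-map-cong xs g≡h = cong sum (map-cong-local (All.tabulate g≡h))

  sum-map-mono : {g h : X → ℕ} (xs : List X) → (∀ {x} → x ∈ xs → g x ≤ h x) →
                 sum (map g xs) ≤ sum (map h xs)
  sum-map-mono []       g≤h = z≤n
  sum-map-mono (x ∷ xs) g≤h = +-mono-≤ (g≤h (here refl)) (sum-map-mono xs (λ x∈ → g≤h (there x∈)))

  ∈⇒≤sum-map : (g : X → ℕ) {x : X} {xs : List X} → x ∈ xs → g x ≤ sum (map g xs)
  ∈⇒≤sum-map g {xs = y ∷ ys} (here refl) = m≤m+n (g y) _
  ∈⇒≤sum-map g {xs = y ∷ ys} (there x∈) = ≤-trans (∈⇒≤sum-map g x∈) (m≤n+m _ (g y))

  length≤sum-map : {g : X → ℕ} (xs : List X) → (∀ {x} → x ∈ xs → 1 ≤ g x) →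
                   length xs ≤ sum (map g xs)
  length≤sum-map []       pos = z≤n
  length≤sum-map (x ∷ xs) pos = +-mono-≤ (pos (here refl)) (length≤sum-map xs (λ x∈ → pos (there x∈)))

  maxOf : (X → ℕ) → List X → ℕ
  maxOf g xs = max 0 (map g xs)

  ∈⇒≤maxOf : (g : X → ℕ) {x : X} {xs : List X} → x ∈ xs → g x ≤ maxOf g xs
  ∈⇒≤maxOf g x∈ = All.lookup (xs≤max 0 (map g _)) (∈-map⁺ g x∈)

  sum-map-set : (g : X → ℕ) {xs ys : List X} → Unique xs → Unique ys → xs ∼[ set ] ys →
                sum (map g xs) ≡ sum (map g ys)
  sum-map-set g u v xs∼ys = sum-↭ (↭.map⁺ g (∼bag⇒↭ (unique∧set⇒bag u v xs∼ys)))

  length-set : {xs ys : List X} → Unique xs → Unique ys → xs ∼[ set ] ys → length xs ≡ length ys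
  length-set u v xs∼ys = ↭-length (∼bag⇒↭ (unique∧set⇒bag u v xs∼ys))

  ∼[set]-nonempty : {xs ys : List X} → xs ≢ [] → xs ∼[ set ] ys → ys ≢ []
  ∼[set]-nonempty {[]}    xs≢[] _     = contradiction refl xs≢[]
  ∼[set]-nonempty {x ∷ _} _     xs∼ys refl with () ← Equivalence.to xs∼ys (here refl)

  []-or-nonempty : (xs : List X) → xs ≡ [] ⊎ xs ≢ []
  []-or-nonempty []      = inj₁ refl
  []-or-nonempty (_ ∷ _) = inj₂ (λ ())

  sublists : List X → List (List X)
  sublists []       = [] ∷ []
  sublists (x ∷ xs) = map (x ∷_) (sublists xs) ++ sublists xs

  filter∈sublists : {P : X → Set} (P? : ∀ x → Dec (P x)) (xs : List X) → filter P? xs ∈ sublists xs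
  filter∈sublists P? []       = here refl
  filter∈sublists P? (x ∷ xs) with P? x
  ... | yes _ = ∈-++⁺ˡ (∈-map⁺ (x ∷_) (filter∈sublists P? xs))
  ... | no  _ = ∈-++⁺ʳ _ (filter∈sublists P? xs)

module _ {X : Set} (_≟_ : DecidableEquality X) where

  remove : X → List X → List X
  remove x = filter (λ y → ¬? (y ≟ x))

  ∈-remove⁻ : ∀ {x y} xs → y ∈ remove x xs → y ∈ xs × y ≢ x
  ∈-remove⁻ xs = ∈-filter⁻ (λ y → ¬? (y ≟ _)) {xs = xs}

  remove-unique : ∀ {x xs} → Unique xs → Unique (remove x xs)
  remove-unique = Unique.filter⁺ (λ y → ¬? (y ≟ _))

  remove-shorter : ∀ {x xs} → x ∈ xs → length (remove x xs) < length xs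
  remove-shorter {xs = xs} x∈ = filter-notAll (λ y → ¬? (y ≟ _)) xs (Any.map (λ x≡y y≢x → y≢x (sym x≡y)) x∈)

  sum-remove : (g : X → ℕ) {x : X} {xs : List X} → Unique xs → x ∈ xs →
               sum (map g xs) ≡ g x + sum (map g (remove x xs))
  sum-remove g {x} {xs} u x∈ = sum-map-set g u (x∉ ∷ remove-unique u) (mk⇔ to from)
    where
    x∉ : All (x ≢_) (remove x xs)
    x∉ = All.tabulate (λ y∈ x≡y → proj₂ (∈-remove⁻ xs y∈) (sym x≡y))
    to : ∀ {y} → y ∈ xs → y ∈ x ∷ remove x xs
    to {y} y∈ with y ≟ x
    ... | yes refl = here refl
    ... | no  y≢x  = there (∈-filter⁺ (λ z → ¬? (z ≟ x)) y∈ y≢x)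
    from : ∀ {y} → y ∈ x ∷ remove x xs → y ∈ xs
    from (here refl) = x∈
    from (there y∈)  = proj₁ (∈-remove⁻ xs y∈)

-- Finite sets of sequences

_≈ˢ_ : SeqSet → SeqSet → Set
F ≈ˢ G = F ⊆ˢ G × G ⊆ˢ F

≈ˢ-refl : ∀ {F} → F ≈ˢ F
≈ˢ-refl = (λ _ f∈ → f∈) , (λ _ f∈ → f∈)

≈ˢ-sym : ∀ {F G} → F ≈ˢ G → G ≈ˢ F
≈ˢ-sym (F⊆G , G⊆F) = G⊆F , F⊆G

≈ˢ-trans : ∀ {F G K} → F ≈ˢ G → G ≈ˢ K → F ≈ˢ K
≈ˢ-trans (F⊆G , G⊆F) (G⊆K , K⊆G) = (λ f f∈ → G⊆K f (F⊆G f f∈)) , (λ f f∈ → G⊆F f (K⊆G f f∈))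

∈ˢ-resp : ∀ {f g : Seq} {G} → f ∈ˢ G → (∀ t → g t ≡ f t) → g ∈ˢ G
∈ˢ-resp f∈ g≗f = Any.map (λ f≗h t → trans (g≗f t) (f≗h t)) f∈

⊊ˢ-respʳ : ∀ {G F F'} → G ⊊ˢ F → F ≈ˢ F' → G ⊊ˢ F'
⊊ˢ-respʳ (G⊆F , g , g∈F , g∉G) (F⊆F' , _) = (λ f f∈ → F⊆F' f (G⊆F f f∈)) , g , F⊆F' g g∈F , g∉G

⊊ˢ-trans : ∀ {F G K} → F ⊊ˢ G → G ⊊ˢ K → F ⊊ˢ K
⊊ˢ-trans (F⊆G , _) (G⊆K , g , g∈K , g∉G) = (λ f f∈ → G⊆K f (F⊆G f f∈)) , g , g∈K , (λ g∈F → g∉G (F⊆G g g∈F))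

∈ˢ⇒lookup : ∀ {f F} → f ∈ˢ F → Σ (Fin (length F)) λ i → ∀ t → f t ≡ lookup F i t
∈ˢ⇒lookup f∈ = Any.index f∈ , lookup-index f∈

lookup∈ˢ : ∀ F (i : Fin (length F)) → lookup F i ∈ˢ F
lookup∈ˢ F i = Any.map (λ g≡h t → cong (λ g → g t) g≡h) (∈-lookup i)

Valid⇒positive : ∀ {f G} → Valid G → f ∈ˢ G → ∀ t → 1 ≤ f t
Valid⇒positive (_ , positive) f∈ t with All.lookupAny positive f∈
... | g-positive , f≗g = subst (1 ≤_) (sym (f≗g t)) (g-positive t)

module Restriction (decide : (Q : Set) → Dec Q) where

  -- For G ⊆ F a representative of G among the finitely many sublists of F.
  restrict : SeqSet → SeqSet → SeqSet
  restrict F G = filter (λ g → decide (g ∈ˢ G)) F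

  restrict⊆ˢ : ∀ F G → restrict F G ⊆ˢ G
  restrict⊆ˢ F G f f∈ with find f∈
  ... | g , g∈ , f≗g = ∈ˢ-resp (proj₂ (∈-filter⁻ (λ g → decide (g ∈ˢ G)) {xs = F} g∈)) f≗g

  ⊆ˢrestrict : ∀ F G → G ⊆ˢ F → G ⊆ˢ restrict F G
  ⊆ˢrestrict F G G⊆F f f∈ with find (G⊆F f f∈)
  ... | g , g∈ , f≗g = lose (∈-filter⁺ (λ g → decide (g ∈ˢ G)) g∈ (∈ˢ-resp f∈ (λ t → sym (f≗g t)))) f≗g

  restrict≈ˢ : ∀ F G → G ⊆ˢ F → restrict F G ≈ˢ G
  restrict≈ˢ F G G⊆F = restrict⊆ˢ F G , ⊆ˢrestrict F G G⊆F

  restrict-shorter : ∀ F G → G ⊊ˢ F → length (restrict F G) < length F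
  restrict-shorter F G (_ , g , g∈F , g∉G) =
    filter-notAll (λ g → decide (g ∈ˢ G)) F (Any.map (λ g≗h h∈G → g∉G (∈ˢ-resp h∈G g≗h)) g∈F)

  restrict∈sublists : ∀ F G → restrict F G ∈ sublists F
  restrict∈sublists F G = filter∈sublists (λ g → decide (g ∈ˢ G)) F

  restrict-valid : ∀ F G → Valid F → Valid G → G ⊆ˢ F → Valid (restrict F G)
  restrict-valid F G (_ , F-positive) (G≢[] , _) G⊆F =
    nonempty G G≢[] (⊆ˢrestrict F G G⊆F) , AllP.filter⁺ (λ g → decide (g ∈ˢ G)) F-positive
    where
    nonempty : ∀ K → K ≢ [] → K ⊆ˢ restrict F G → restrict F G ≢ []
    nonempty []      K≢[] _   = contradiction refl K≢[]
    nonempty (g ∷ _) _    K⊆R R≡[] with () ← subst (g ∈ˢ_) R≡[] (K⊆R g (here (λ _ → refl)))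

-- Ultrafilters

idPoly : Poly
idPoly = record { coeffs = ℤ.+ 1 ∷ [] ; intoℕ = λ { (suc n) _ → ℤ.+≤+ (s≤s z≤n) } }

module _ (p : Ultrafilter) where

  mem-all : ∀ {X : Subset} → (∀ n → X n) → mem p X
  mem-all X-all = up p (λ n _ → X-all n) (onPos p)

  mem-All : {Y : Set} {X : Y → Subset} {ys : List Y} →
            All (λ y → mem p (X y)) ys → mem p (λ n → All (λ y → X y n) ys)
  mem-All []       = mem-all (λ _ → [])
  mem-All (m ∷ ms) = up p (λ _ (x , xs) → x ∷ xs) (inter p m (mem-All ms))

module Classical (p : Ultrafilter) (p∈𝒥 : InJp p) where

  mem⇒inhabited : ∀ {X} → mem p X → Σ ℕ X
  mem⇒inhabited {X} X∈p with p∈𝒥 X X∈p (idPoly ∷ []) 1 (λ _ _ → 1) (λ _ _ → s≤s z≤n)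
  ... | _ , _ , _ , in-X = _ , in-X idPoly (here refl) Fin.zero

  -- p contains either the constant set Q or its complement, and that set is inhabited.
  decide : (Q : Set) → Dec Q
  decide Q with ultra p (λ _ → Q)
  ... | inj₁ Q∈p  = yes (proj₂ (mem⇒inhabited Q∈p))
  ... | inj₂ ¬Q∈p = no  (proj₂ (mem⇒inhabited ¬Q∈p))

  mem-⇒ : {Q : Set} {X : Subset} → (Q → mem p X) → mem p (λ n → Q → X n)
  mem-⇒ {Q} Q⇒X∈p with decide Q
  ... | yes q  = up p (λ _ x _ → x) (Q⇒X∈p q)
  ... | no  ¬q = mem-all p (λ _ q → contradiction q ¬q)

module Star (p : Ultrafilter) (p-idem : Idempotent p) where

  _⋆ : Subset → Subset
  (A ⋆) x = A x × mem p (λ y → A (x + y))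

  mem-⋆ : ∀ {A} → mem p A → mem p (A ⋆)
  mem-⋆ {A} A∈p = inter p A∈p (proj₂ (p-idem A) A∈p)

  ⋆-shift : ∀ {A x} → (A ⋆) x → mem p (λ y → (A ⋆) (x + y))
  ⋆-shift {A} {x} (_ , -x+A∈p) =
    inter p -x+A∈p (up p (λ y → up p (λ z → subst A (sym (+-assoc x y z))))
                         (proj₂ (p-idem (λ y → A (x + y))) -x+A∈p))

-- Canonical choice

record Code : Set where
  constructor code
  field
    α     : ℕ
    H     : List ℕ
    bound : ℕ

open Code

candidates : ℕ → List Code
candidates B =
  map (λ ((a , h) , w) → code a h w)
      (cartesianProduct (cartesianProduct (downFrom B) (sublists (downFrom B))) (downFrom B))

normalise : ℕ → List ℕ → List ℕ
normalise B h = filter (_∈ℕ? h) (downFrom B)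

normalise-unique : ∀ B h → Unique (normalise B h)
normalise-unique B h = Unique.filter⁺ (_∈ℕ? h) (Unique.downFrom⁺ B)

normalise∼ : ∀ {B h} → (∀ {s} → s ∈ h → s < B) → h ∼[ set ] normalise B h
normalise∼ {B} {h} h<B =
  mk⇔ (λ s∈ → ∈-filter⁺ (_∈ℕ? h) (∈-downFrom⁺ (h<B s∈)) s∈)
      (λ s∈ → proj₂ (∈-filter⁻ (_∈ℕ? h) {xs = downFrom B} s∈))

normalised∈candidates : ∀ {B a h w} → a < B → w < B → (∀ {s} → s ∈ h → s < B) →
                        code a (normalise B h) w ∈ candidates B
normalised∈candidates {B} {h = h} a<B w<B _ =
  ∈-map⁺ _ (∈-cartesianProduct⁺ (∈-cartesianProduct⁺ (∈-downFrom⁺ a<B)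
                                                       (filter∈sublists (_∈ℕ? h) (downFrom B)))
                                 (∈-downFrom⁺ w<B))

module Choice (decide : (Q : Set) → Dec Q) where

  least≤ : (ℕ → Set) → ℕ → ℕ
  least≤ Q zero    = 0
  least≤ Q (suc n) with decide (Σ ℕ λ m → m ≤ n × Q m)
  ... | yes _ = least≤ Q n
  ... | no  _ = suc n

  least≤-spec : ∀ Q n → (Σ ℕ λ m → m ≤ n × Q m) → Q (least≤ Q n) × (∀ m → m < least≤ Q n → ¬ Q m)
  least≤-spec Q zero    (zero , _ , q) = q , λ _ ()
  least≤-spec Q (suc n) (m , m≤1+n , q) with decide (Σ ℕ λ m → m ≤ n × Q m)
  ... | yes below = least≤-spec Q n below
  ... | no  none  = Q[1+n] , λ k k<1+n q → none (k , ≤-pred k<1+n , q)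
    where
    Q[1+n] : Q (suc n)
    Q[1+n] with m ≟ suc n
    ... | yes refl = q
    ... | no  m≢1+n = contradiction (m , ≤-pred (≤∧≢⇒< m≤1+n m≢1+n) , q) none

  least : (ℕ → Set) → ℕ
  least Q with decide (Σ ℕ Q)
  ... | yes (n , _) = least≤ Q n
  ... | no  _       = 0

  least-spec : ∀ Q → Σ ℕ Q → Q (least Q) × (∀ m → m < least Q → ¬ Q m)
  least-spec Q ∃Q with decide (Σ ℕ Q)
  ... | yes (n , q) = least≤-spec Q n (n , ≤-refl , q)
  ... | no  ∄Q      = contradiction ∃Q ∄Q

  least-cong : ∀ {Q Q'} → (∀ m → Q m ⇔ Q' m) → least Q ≡ least Q'
  least-cong {Q} {Q'} Q⇔Q' with decide (Σ ℕ Q)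
  ... | no ∄Q = sym (least-none λ (m , q') → ∄Q (m , Equivalence.from (Q⇔Q' m) q'))
    where
    least-none : ¬ Σ ℕ Q' → least Q' ≡ 0
    least-none ∄Q' with decide (Σ ℕ Q')
    ... | yes ∃Q' = contradiction ∃Q' ∄Q'
    ... | no  _   = refl
  ... | yes (n , q) with least-spec Q' (n , Equivalence.to (Q⇔Q' n) q)
  ... | q' , below' with least≤-spec Q n (n , ≤-refl , q)
  ... | q₀ , below₀ with <-cmp (least≤ Q n) (least Q')
  ... | tri< lt _ _ = contradiction (Equivalence.to (Q⇔Q' _) q₀) (below' _ lt)
  ... | tri≈ _ eq _ = eq
  ... | tri> _ _ gt = contradiction (Equivalence.from (Q⇔Q' _) q') (below₀ _ gt)

  first : (Code → Set) → List Code → Code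
  first Q []       = code 0 [] 0
  first Q (c ∷ cs) with decide (Q c)
  ... | yes _ = c
  ... | no  _ = first Q cs

  first-spec : ∀ Q cs → Any Q cs → Q (first Q cs)
  first-spec Q (c ∷ cs) Q-somewhere with decide (Q c) | Q-somewhere
  ... | yes q  | _          = q
  ... | no  ¬q | here q     = contradiction q ¬q
  ... | no  _  | there rest = first-spec Q cs rest

  first-cong : ∀ {Q Q'} → (∀ c → Q c ⇔ Q' c) → ∀ cs → first Q cs ≡ first Q' cs
  first-cong         Q⇔Q' []       = refl
  first-cong {Q} {Q'} Q⇔Q' (c ∷ cs) with decide (Q c) | decide (Q' c)
  ... | yes _ | yes _  = refl
  ... | yes q | no ¬q' = contradiction (Equivalence.to (Q⇔Q' c) q) ¬q'
  ... | no ¬q | yes q' = contradiction (Equivalence.from (Q⇔Q' c) q') ¬q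
  ... | no _  | no _   = first-cong Q⇔Q' cs

  -- A choice of code that depends only on the extension of Q.
  choose : (Code → Set) → Code
  choose Q = first Q (candidates (least (λ B → Any Q (candidates B))))

  choose-spec : ∀ Q B → Any Q (candidates B) → Q (choose Q)
  choose-spec Q B Q-in-B =
    first-spec Q _ (proj₁ (least-spec (λ B → Any Q (candidates B)) (B , Q-in-B)))

  choose-cong : ∀ {Q Q'} → (∀ c → Q c ⇔ Q' c) → choose Q ≡ choose Q'
  choose-cong {Q} {Q'} Q⇔Q' =
    trans (cong (λ B → first Q (candidates B)) (least-cong Any⇔))
          (first-cong Q⇔Q' (candidates (least (λ B → Any Q' (candidates B)))))
    where
    Any⇔ : ∀ B → Any Q (candidates B) ⇔ Any Q' (candidates B)
    Any⇔ B = mk⇔ (Any.map (Equivalence.to (Q⇔Q' _))) (Any.map (Equivalence.from (Q⇔Q' _)))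

module Blocks (b L : ℕ) .{{_ : NonZero L}} where

  block : ℕ → List ℕ
  block t = map (λ j → b + (t * L + j)) (downFrom L)

  length-block : ∀ t → length (block t) ≡ L
  length-block t = trans (length-map _ (downFrom L)) (length-downFrom L)

  ∈block⇒ : ∀ {s} t → s ∈ block t → Σ ℕ λ j → j < L × s ≡ b + (t * L + j)
  ∈block⇒ t s∈ with j , j∈ , refl ← ∈-map⁻ _ s∈ = j , ∈-downFrom⁻ j∈ , refl

  ∈block⇒≥ : ∀ {s} t → s ∈ block t → b ≤ s
  ∈block⇒≥ t s∈ with _ , _ , refl ← ∈block⇒ t s∈ = m≤m+n b _

  block-unique : ∀ t → Unique (block t)
  block-unique t = Unique.map⁺ (λ {j} {j'} eq → +-cancelˡ-≡ (t * L) j j' (+-cancelˡ-≡ b _ _ eq))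
                               (Unique.downFrom⁺ L)

  blockOf : ℕ → ℕ
  blockOf s = (s ∸ b) / L

  ∈block⇒blockOf : ∀ {s} t → s ∈ block t → blockOf s ≡ t
  ∈block⇒blockOf t s∈ with j , j<L , refl ← ∈block⇒ t s∈ = begin
    (b + (t * L + j) ∸ b) / L   ≡⟨ cong (_/ L) (m+n∸m≡n b (t * L + j)) ⟩
    (t * L + j) / L             ≡⟨ +-distrib-/-∣ˡ j (divides-refl t) ⟩
    t * L / L + j / L           ≡⟨ cong₂ _+_ (m*n/n≡m t L) (m<n⇒m/n≡0 j<L) ⟩
    t + 0                       ≡⟨ +-identityʳ t ⟩
    t                           ∎
    where open ≡-Reasoning

  blocks : List ℕ → List ℕ
  blocks = concatMap block

  ∈blocks⇒ : ∀ {s} γ → s ∈ blocks γ → Σ ℕ λ t → t ∈ γ × s ∈ block t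
  ∈blocks⇒ γ s∈ with t , t∈ , s∈block ← find (∈-concatMap⁻ block {xs = γ} s∈) = t , t∈ , s∈block

  ∈blocks⇒≥ : ∀ {s} γ → s ∈ blocks γ → b ≤ s
  ∈blocks⇒≥ γ s∈ with t , _ , s∈block ← ∈blocks⇒ γ s∈ = ∈block⇒≥ t s∈block

  blocks-unique : ∀ {γ} → Unique γ → Unique (blocks γ)
  blocks-unique {[]}    _              = []
  blocks-unique {t ∷ γ} (t∉γ ∷ γ-unique) = Unique.++⁺ (block-unique t) (blocks-unique γ-unique) disjoint
    where
    disjoint : ∀ {s} → ¬ (s ∈ block t × s ∈ blocks γ)
    disjoint (s∈t , s∈γ) with t' , t'∈ , s∈t' ← ∈blocks⇒ γ s∈γ =
      All.lookup t∉γ t'∈ (trans (sym (∈block⇒blockOf t s∈t)) (∈block⇒blockOf t' s∈t'))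

  sum-blocks : (f : ℕ → ℕ) → ∀ γ → sum (map f (blocks γ)) ≡ sum (map (λ t → sum (map f (block t))) γ)
  sum-blocks f []      = refl
  sum-blocks f (t ∷ γ) = begin
    sum (map f (block t ++ blocks γ))               ≡⟨ cong sum (map-++ f (block t) (blocks γ)) ⟩
    sum (map f (block t) ++ map f (blocks γ))       ≡⟨ sum-++ (map f (block t)) _ ⟩
    sum (map f (block t)) + sum (map f (blocks γ))  ≡⟨ cong (sum (map f (block t)) +_) (sum-blocks f γ) ⟩
    sum (map f (block t)) + sum (map (λ t → sum (map f (block t))) γ) ∎
    where open ≡-Reasoning

  length-blocks : ∀ {γ} → γ ≢ [] → L ≤ length (blocks γ)
  length-blocks {[]}    γ≢[] = contradiction refl γ≢[]
  length-blocks {t ∷ γ} _    = begin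
    L                                  ≡⟨ length-block t ⟨
    length (block t)                   ≤⟨ m≤m+n _ _ ⟩
    length (block t) + length (blocks γ) ≡⟨ length-++ (block t) ⟨
    length (blocks (t ∷ γ))            ∎
    where open ≤-Reasoning

  blocks-nonempty : ∀ {γ} → γ ≢ [] → blocks γ ≢ []
  blocks-nonempty γ≢[] blocks≡[] = contradiction L≤0 (<⇒≱ (>-nonZero⁻¹ L))
    where
    L≤0 : L ≤ 0
    L≤0 = subst (λ bs → L ≤ length bs) blocks≡[] (length-blocks γ≢[])

-- Chains and the construction

record Chain (n : ℕ) : Set where
  field
    G      : Fin n → SeqSet
    valid  : ∀ i → Valid (G i)
    strict : ∀ i j → toℕ j ≡ suc (toℕ i) → G i ⊊ˢ G j
    f      : Fin n → Seq
    f∈G    : ∀ i → f i ∈ˢ G i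

  ⊊ˢ-along : ∀ i j → toℕ i < toℕ j → G i ⊊ˢ G j
  ⊊ˢ-along i j i<j = go (toℕ j ∸ suc (toℕ i)) j (sym (m∸n+n≡m i<j))
    where
    go : ∀ d j → toℕ j ≡ d + suc (toℕ i) → G i ⊊ˢ G j
    go zero    j j≡ = strict i j j≡
    go (suc d) j j≡ = ⊊ˢ-trans (go d k (toℕ-fromℕ< k<n)) (strict k j (trans j≡ (cong suc (sym (toℕ-fromℕ< k<n)))))
      where
      k<n : d + suc (toℕ i) < n
      k<n = <-trans (n<1+n _) (subst (_< n) j≡ (toℕ<n j))
      k : Fin n
      k = fromℕ< k<n

module _ {n : ℕ} where

  record MaxSplit (β : List (Fin n)) : Set where
    field
      top        : Fin n
      top∈       : top ∈ β
      rest-below : ∀ {i} → i ∈ remove _≟ᶠ_ top β → toℕ i < toℕ top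

  maxSplit : ∀ {β} → β ≢ [] → MaxSplit β
  maxSplit {[]}     β≢[] = contradiction refl β≢[]
  maxSplit {x ∷ xs} _    = record { top = M ; top∈ = M∈ ; rest-below = below }
    where
    M : Fin n
    M = argmax toℕ x xs
    M∈ : M ∈ x ∷ xs
    M∈ with argmax-sel toℕ x xs
    ... | inj₁ M≡x  = here M≡x
    ... | inj₂ M∈xs = there M∈xs
    below : ∀ {i} → i ∈ remove _≟ᶠ_ M (x ∷ xs) → toℕ i < toℕ M
    below {i} i∈ with i∈x∷xs , i≢M ← ∈-remove⁻ _≟ᶠ_ (x ∷ xs) i∈ =
      ≤∧≢⇒< (≤M i∈x∷xs) (λ i≡M → i≢M (toℕ-injective i≡M))
      where
      ≤M : ∀ {i} → i ∈ x ∷ xs → toℕ i ≤ toℕ M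
      ≤M (here refl)  = f[⊥]≤f[argmax] {f = toℕ} x xs
      ≤M (there i∈xs) = All.lookup (f[xs]≤f[argmax] {f = toℕ} x xs) i∈xs

module Sums (r : SeqSet → Code) {n : ℕ} (ch : Chain n) where
  open Chain ch

  αSum : List (Fin n) → ℕ
  αSum β = sum (map (λ i → α (r (G i))) β)

  HSum : List (Fin n) → ℕ
  HSum β = sum (map (λ i → Σ[ f i ∈ H (r (G i)) ]) β)

Below : ∀ {n} → Chain n → List (Fin n) → SeqSet → Set
Below ch β F = ∀ {i} → i ∈ β → Chain.G ch i ⊊ˢ F

open Sums

module Construction (A : Subset) (p : Ultrafilter) (p-idem : Idempotent p) (p∈𝒥 : InJp p)
                    (S : List Poly) where

  open Classical p p∈𝒥
  open Star p p-idem
  open Restriction decide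
  open Choice decide

  L : ℕ
  L = suc (maxOf threshold S)

  threshold≤L : ∀ {P} → P ∈ S → threshold P ≤ L
  threshold≤L P∈ = m≤n⇒m≤1+n (∈⇒≤maxOf threshold P∈)

  -- H-large makes the
  -- H-sums along chains at least L, beyond every threshold; the bound dominates α + H-sums along
  -- every chain ending at F, so only finitely many sums from chains below F matter at F.
  record Admissible (r : SeqSet → Code) (F : SeqSet) (c : Code) : Set where
    field
      α-positive : 1 ≤ α c
      H-finite   : IsNEFin (H c)
      H-large    : L ≤ length (H c)
      H-above    : ∀ G → Valid G → G ⊊ˢ F → ∀ s t → s ∈ H (r G) → t ∈ H c → s < t
      bound-base : ∀ f → f ∈ˢ F → α c + Σ[ f ∈ H c ] ≤ bound c
      bound-step : ∀ G → Valid G → G ⊊ˢ F → ∀ f → f ∈ˢ F → α c + Σ[ f ∈ H c ] + bound (r G) ≤ bound c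
      base∈A⋆    : ∀ f → f ∈ˢ F → ∀ P → P ∈ S → (A ⋆) (α c + ⟦ P ⟧ (Σ[ f ∈ H c ]))
      step∈A⋆    : ∀ {n} (ch : Chain n) β → IsNEFin β → Below ch β F → ∀ f → f ∈ˢ F → ∀ P → P ∈ S →
                   (A ⋆) ((αSum r ch β + α c) + ⟦ P ⟧ (HSum r ch β + Σ[ f ∈ H c ]))

  open Admissible public

  Admissible-transfer : ∀ {r r' F F' c} → F ≈ˢ F' → (∀ G → Valid G → G ⊊ˢ F → r G ≡ r' G) →
                        Admissible r F c → Admissible r' F' c
  Admissible-transfer {r} {r'} {F} {F'} {c} F≈F' r≡r' adm = record
    { α-positive = α-positive adm
    ; H-finite   = H-finite adm
    ; H-large    = H-large adm
    ; H-above    = λ G G-valid G⊊F' s t s∈ t∈ →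
        H-above adm G G-valid (back G⊊F') s t (subst (λ k → s ∈ H k) (sym (r≡r' G G-valid (back G⊊F'))) s∈) t∈
    ; bound-base = λ f f∈ → bound-base adm f (F'⊆F f f∈)
    ; bound-step = λ G G-valid G⊊F' f f∈ →
        subst (λ k → α c + Σ[ f ∈ H c ] + bound k ≤ bound c) (r≡r' G G-valid (back G⊊F'))
              (bound-step adm G G-valid (back G⊊F') f (F'⊆F f f∈))
    ; base∈A⋆    = λ f f∈ → base∈A⋆ adm f (F'⊆F f f∈)
    ; step∈A⋆    = λ ch β β-finite below f f∈ P P∈ →
        subst₂ (λ u y → (A ⋆) ((u + α c) + ⟦ P ⟧ (y + Σ[ f ∈ H c ])))
               (sum-map-cong β (λ i∈ → cong α (same ch below i∈)))
               (sum-map-cong β (λ {i} i∈ → cong (λ k → Σ[ Chain.f ch i ∈ H k ]) (same ch below i∈)))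
               (step∈A⋆ adm ch β β-finite (λ i∈ → back (below i∈)) f (F'⊆F f f∈) P P∈)
    }
    where
    F'⊆F : F' ⊆ˢ F
    F'⊆F = proj₂ F≈F'
    back : ∀ {G} → G ⊊ˢ F' → G ⊊ˢ F
    back G⊊F' = ⊊ˢ-respʳ G⊊F' (≈ˢ-sym F≈F')
    same : ∀ {n} (ch : Chain n) {β} → Below ch β F' → ∀ {i} → i ∈ β → r (Chain.G ch i) ≡ r' (Chain.G ch i)
    same ch below i∈ = r≡r' _ (Chain.valid ch _) (back (below i∈))

  Admissible-resupport : ∀ {r F c h} → Unique h → H c ∼[ set ] h → Admissible r F c →
                         Admissible r F (record c { H = h })
  Admissible-resupport {r} {F} {c} {h} h-unique H∼h adm = record
    { α-positive = α-positive adm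
    ; H-finite   = ∼[set]-nonempty (proj₁ (H-finite adm)) H∼h , h-unique
    ; H-large    = subst (L ≤_) (length-set H-unique h-unique H∼h) (H-large adm)
    ; H-above    = λ G G-valid G⊊F s t s∈ t∈ → H-above adm G G-valid G⊊F s t s∈ (Equivalence.from H∼h t∈)
    ; bound-base = λ f f∈ → subst (λ v → α c + v ≤ bound c) (Σ≡ f) (bound-base adm f f∈)
    ; bound-step = λ G G-valid G⊊F f f∈ →
        subst (λ v → α c + v + bound (r G) ≤ bound c) (Σ≡ f) (bound-step adm G G-valid G⊊F f f∈)
    ; base∈A⋆    = λ f f∈ P P∈ → subst (λ v → (A ⋆) (α c + ⟦ P ⟧ v)) (Σ≡ f) (base∈A⋆ adm f f∈ P P∈)
    ; step∈A⋆    = λ ch β β-finite below f f∈ P P∈ →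
        subst (λ v → (A ⋆) ((αSum r ch β + α c) + ⟦ P ⟧ (HSum r ch β + v))) (Σ≡ f)
              (step∈A⋆ adm ch β β-finite below f f∈ P P∈)
    }
    where
    H-unique : Unique (H c)
    H-unique = proj₂ (H-finite adm)
    Σ≡ : ∀ f → Σ[ f ∈ H c ] ≡ Σ[ f ∈ h ]
    Σ≡ f = sum-map-set f H-unique h-unique H∼h

  module ChainBounds (r : SeqSet → Code) {n : ℕ} (ch : Chain n) where
    open Chain ch

    AllAdmissible : List (Fin n) → Set
    AllAdmissible β = ∀ {i} → i ∈ β → Admissible r (G i) (r (G i))

    module TopSplit {β : List (Fin n)} (β-finite : IsNEFin β) where
      open MaxSplit (maxSplit (proj₁ β-finite)) public

      rest : List (Fin n)
      rest = remove _≟ᶠ_ top β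

      rest-unique : Unique rest
      rest-unique = remove-unique _≟ᶠ_ (proj₂ β-finite)

      rest⊆ : ∀ {i} → i ∈ rest → i ∈ β
      rest⊆ i∈ = proj₁ (∈-remove⁻ _≟ᶠ_ β i∈)

      rest-below-top : Below ch rest (G top)
      rest-below-top i∈ = ⊊ˢ-along _ top (rest-below i∈)

      αSum-split : αSum r ch β ≡ α (r (G top)) + αSum r ch rest
      αSum-split = sum-remove _≟ᶠ_ (λ i → α (r (G i))) (proj₂ β-finite) top∈

      HSum-split : HSum r ch β ≡ Σ[ f top ∈ H (r (G top)) ] + HSum r ch rest
      HSum-split = sum-remove _≟ᶠ_ (λ i → Σ[ f i ∈ H (r (G i)) ]) (proj₂ β-finite) top∈

      αSum-single : rest ≡ [] → αSum r ch β ≡ α (r (G top))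
      αSum-single rest≡[] =
        trans αSum-split (trans (cong (λ is → α (r (G top)) + αSum r ch is) rest≡[]) (+-identityʳ _))

      HSum-single : rest ≡ [] → HSum r ch β ≡ Σ[ f top ∈ H (r (G top)) ]
      HSum-single rest≡[] = trans HSum-split
        (trans (cong (λ is → Σ[ f top ∈ H (r (G top)) ] + HSum r ch is) rest≡[]) (+-identityʳ _))

    chain∈A⋆ : ∀ β (β-finite : IsNEFin β) → AllAdmissible β →
               ∀ P → P ∈ S → (A ⋆) (αSum r ch β + ⟦ P ⟧ (HSum r ch β))
    chain∈A⋆ β β-finite adm P P∈ = split ([]-or-nonempty rest)
      where
      open TopSplit β-finite
      split : rest ≡ [] ⊎ rest ≢ [] → (A ⋆) (αSum r ch β + ⟦ P ⟧ (HSum r ch β))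
      split (inj₁ rest≡[]) =
        subst₂ (λ u y → (A ⋆) (u + ⟦ P ⟧ y)) (sym (αSum-single rest≡[])) (sym (HSum-single rest≡[]))
               (base∈A⋆ (adm top∈) (f top) (f∈G top) P P∈)
      split (inj₂ rest≢[]) =
        subst₂ (λ u y → (A ⋆) (u + ⟦ P ⟧ y))
               (sym (trans αSum-split (+-comm (α (r (G top))) (αSum r ch rest))))
               (sym (trans HSum-split (+-comm (Σ[ f top ∈ H (r (G top)) ]) (HSum r ch rest))))
               (step∈A⋆ (adm top∈) ch rest (rest≢[] , rest-unique) rest-below-top (f top) (f∈G top) P P∈)

    chain-bounded : ∀ β (β-finite : IsNEFin β) → AllAdmissible β →
                    αSum r ch β + HSum r ch β ≤ bound (r (G (TopSplit.top β-finite)))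
    chain-bounded β β-finite = bounded (suc (length β)) β β-finite ≤-refl
      where
      bounded : ∀ k β (β-finite : IsNEFin β) → length β < k → AllAdmissible β →
                αSum r ch β + HSum r ch β ≤ bound (r (G (TopSplit.top β-finite)))
      bounded (suc k) β β-finite |β|≤k adm = split ([]-or-nonempty rest)
        where
        open TopSplit β-finite
        αtop Htop : ℕ
        αtop = α (r (G top))
        Htop = Σ[ f top ∈ H (r (G top)) ]
        split : rest ≡ [] ⊎ rest ≢ [] → αSum r ch β + HSum r ch β ≤ bound (r (G top))
        split (inj₁ rest≡[]) =
          subst₂ (λ u y → u + y ≤ bound (r (G top))) (sym (αSum-single rest≡[])) (sym (HSum-single rest≡[]))
                 (bound-base (adm top∈) (f top) (f∈G top))
        split (inj₂ rest≢[]) = begin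
          αSum r ch β + HSum r ch β                          ≡⟨ cong₂ _+_ αSum-split HSum-split ⟩
          (αtop + αSum r ch rest) + (Htop + HSum r ch rest)  ≡⟨ +-interchange αtop _ Htop _ ⟩
          (αtop + Htop) + (αSum r ch rest + HSum r ch rest)  ≤⟨ +-monoʳ-≤ (αtop + Htop) rest-bounded ⟩
          αtop + Htop + bound (r (G top'))                   ≤⟨ top-step ⟩
          bound (r (G top))                                  ∎
          where
          open ≤-Reasoning
          rest-finite : IsNEFin rest
          rest-finite = rest≢[] , rest-unique
          top' : Fin n
          top' = TopSplit.top rest-finite
          rest-bounded : αSum r ch rest + HSum r ch rest ≤ bound (r (G top'))
          rest-bounded = bounded k rest rest-finite (≤-trans (remove-shorter _≟ᶠ_ top∈) (≤-pred |β|≤k))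
                                 (λ i∈ → adm (rest⊆ i∈))
          top-step : αtop + Htop + bound (r (G top')) ≤ bound (r (G top))
          top-step = bound-step (adm top∈) (G top') (valid top') (rest-below-top (TopSplit.top∈ rest-finite))
                                (f top) (f∈G top)

  module Step (A∈p : mem p A) (r : SeqSet → Code) (r-resp : ∀ {G G'} → G ≈ˢ G' → r G ≡ r G')
              (F : SeqSet) (F-valid : Valid F) (IH : ∀ G → Valid G → G ⊊ˢ F → Admissible r G (r G)) where

    r-restrict : ∀ {G} → G ⊊ˢ F → r G ≡ r (restrict F G)
    r-restrict G⊊F = r-resp (≈ˢ-sym (restrict≈ˢ F _ (proj₁ G⊊F)))

    maxH : ℕ
    maxH = maxOf (λ G → maxOf (λ s → s) (H (r G))) (sublists F)

    H-bounded : ∀ {G} → G ⊊ˢ F → ∀ {s} → s ∈ H (r G) → s ≤ maxH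
    H-bounded {G} G⊊F {s} s∈ =
      ≤-trans (∈⇒≤maxOf (λ s → s) (subst (λ k → s ∈ H k) (r-restrict G⊊F) s∈))
              (∈⇒≤maxOf (λ G → maxOf (λ s → s) (H (r G))) (restrict∈sublists F G))

    K : ℕ
    K = maxOf (λ G → bound (r G)) (sublists F)

    bound-bounded : ∀ {G} → G ⊊ˢ F → bound (r G) ≤ K
    bound-bounded {G} G⊊F = subst (_≤ K) (cong bound (sym (r-restrict G⊊F)))
                                  (∈⇒≤maxOf (λ G → bound (r G)) (restrict∈sublists F G))

    range : List ℕ
    range = downFrom (suc K)

    record Realised (u y : ℕ) : Set where
      constructor realised
      field
        {n}      : ℕ
        ch       : Chain n
        β        : List (Fin n)
        β-finite : IsNEFin β
        below    : Below ch β F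
        u≡       : αSum r ch β ≡ u
        y≡       : HSum r ch β ≡ y

    below⇒admissible : ∀ {n} (ch : Chain n) {β} → Below ch β F → ChainBounds.AllAdmissible r ch β
    below⇒admissible ch below i∈ = IH _ (Chain.valid ch _) (below i∈)

    realised∈A⋆ : ∀ {u y} → Realised u y → ∀ {P} → P ∈ S → (A ⋆) (u + ⟦ P ⟧ y)
    realised∈A⋆ (realised ch β β-finite below refl refl) {P} P∈ =
      ChainBounds.chain∈A⋆ r ch β β-finite (below⇒admissible ch below) P P∈

    realised-bounded : ∀ {u y} → Realised u y → u + y ≤ K
    realised-bounded (realised ch β β-finite below refl refl) =
      ≤-trans (ChainBounds.chain-bounded r ch β β-finite (below⇒admissible ch below)) (bound-bounded (below top∈))
      where open ChainBounds.TopSplit r ch β-finite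

    realised-large : ∀ {u y} → Realised u y → L ≤ y
    realised-large (realised ch β β-finite below refl refl) = begin
      L                              ≤⟨ H-large (below⇒admissible ch below top∈) ⟩
      length (H (r (G top)))         ≤⟨ length≤sum-map (H (r (G top))) (λ _ → f-positive _) ⟩
      Σ[ f top ∈ H (r (G top)) ]     ≤⟨ ∈⇒≤sum-map (λ i → Σ[ f i ∈ H (r (G i)) ]) top∈ ⟩
      HSum r ch β                    ∎
      where
      open Chain ch
      open ChainBounds.TopSplit r ch β-finite
      open ≤-Reasoning
      f-positive : ∀ t → 1 ≤ f top t
      f-positive = Valid⇒positive (valid top) (f∈G top)

    realised-range : ∀ {u y} → Realised u y → u ∈ range × y ∈ range
    realised-range ρ = ∈-downFrom⁺ (s≤s (≤-trans (m≤m+n _ _) (realised-bounded ρ))) ,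
                       ∈-downFrom⁺ (s≤s (≤-trans (m≤n+m _ _) (realised-bounded ρ)))

    C : Subset
    C z = (A ⋆) z × All (λ u → All (λ y → Realised u y → All (λ P → (A ⋆) (u + ⟦ P ⟧ y + z)) S) range) range

    C-absorbs : ∀ {z u y} → C z → Realised u y → ∀ {P} → P ∈ S → (A ⋆) (u + ⟦ P ⟧ y + z)
    C-absorbs (_ , absorbs) ρ P∈ with u∈ , y∈ ← realised-range ρ =
      All.lookup (All.lookup (All.lookup absorbs u∈) y∈ ρ) P∈

    C∈p : mem p C
    C∈p = inter p (mem-⋆ A∈p)
      (mem-All p (All.tabulate λ {u} _ → mem-All p (All.tabulate λ {y} _ → mem-⇒ λ ρ →
        mem-All p (All.tabulate λ {P} P∈ → ⋆-shift {A} (realised∈A⋆ ρ P∈)))))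

    z₀-pack : Σ ℕ λ z → mem p (λ t → C (z + t)) × 1 ≤ z
    z₀-pack = mem⇒inhabited (inter p (proj₂ (p-idem C) C∈p) (onPos p))

    z₀ : ℕ
    z₀ = proj₁ z₀-pack

    D : Subset
    D t = C (z₀ + t)

    polys : List Poly
    polys = S ++ concatMap (λ y → map (λ P → incrementPoly P y) S) range

    S⊆polys : ∀ {P} → P ∈ S → P ∈ polys
    S⊆polys = ∈-++⁺ˡ

    increment∈polys : ∀ {P y} → P ∈ S → y ∈ range → incrementPoly P y ∈ polys
    increment∈polys {P} {y} P∈ y∈ =
      ∈-++⁺ʳ S (∈-concatMap⁺ (λ y' → map (λ P → incrementPoly P y') S)
                             (lose y∈ (∈-map⁺ (λ P → incrementPoly P y) P∈)))

    open Blocks (suc maxH) L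

    x : Fin (length F) → ℕ → ℕ
    x i t = Σ[ lookup F i ∈ block t ]

    x-positive : ∀ i t → 1 ≤ x i t
    x-positive i t = ≤-trans (s≤s z≤n) (subst (_≤ x i t) (length-block t)
      (length≤sum-map (block t) (λ _ → Valid⇒positive F-valid (lookup∈ˢ F i) _)))

    J-witness : Σ ℕ λ a → Σ (List ℕ) λ γ → IsNEFin γ ×
                  (∀ Q → Q ∈ polys → ∀ i → D (a + ⟦ Q ⟧ (Σ[ x i ∈ γ ])))
    J-witness = p∈𝒥 D (proj₁ (proj₂ z₀-pack)) polys (length F) x x-positive

    a' : ℕ
    a' = proj₁ J-witness

    γ : List ℕ
    γ = proj₁ (proj₂ J-witness)

    γ-finite : IsNEFin γ
    γ-finite = proj₁ (proj₂ (proj₂ J-witness))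

    hit : ∀ Q → Q ∈ polys → ∀ i → D (a' + ⟦ Q ⟧ (Σ[ x i ∈ γ ]))
    hit = proj₂ (proj₂ (proj₂ J-witness))

    Σ-blocks : ∀ {f} i → (∀ t → f t ≡ lookup F i t) → Σ[ f ∈ blocks γ ] ≡ Σ[ x i ∈ γ ]
    Σ-blocks {f} i f≗ = trans (sum-map-cong (blocks γ) (λ _ → f≗ _)) (sum-blocks (lookup F i) γ)

    F-max : Seq
    F-max t = sum (map (λ g → g t) F)

    Σ≤Σ-F-max : ∀ {f} → f ∈ˢ F → Σ[ f ∈ blocks γ ] ≤ Σ[ F-max ∈ blocks γ ]
    Σ≤Σ-F-max {f} f∈ = sum-map-mono {g = f} {h = F-max} (blocks γ) (λ {t} _ → f≤F-max t)
      where
      f≤F-max : ∀ t → f t ≤ F-max t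
      f≤F-max t with i , f≗ ← ∈ˢ⇒lookup f∈ =
        subst (_≤ F-max t) (sym (f≗ t)) (∈⇒≤sum-map (λ g → g t) (∈-lookup {xs = F} i))

    extension : Code
    extension = code (z₀ + a') (blocks γ) (z₀ + a' + Σ[ F-max ∈ blocks γ ] + K)

    extension-base : ∀ i {f} → (∀ t → f t ≡ lookup F i t) → ∀ {P} → P ∈ S →
                     (A ⋆) (z₀ + a' + ⟦ P ⟧ (Σ[ f ∈ blocks γ ]))
    extension-base i {f} f≗ {P} P∈ = subst (A ⋆) regroup (proj₁ (hit P (S⊆polys P∈) i))
      where
      open ≡-Reasoning
      regroup : z₀ + (a' + ⟦ P ⟧ (Σ[ x i ∈ γ ])) ≡ z₀ + a' + ⟦ P ⟧ (Σ[ f ∈ blocks γ ])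
      regroup = begin
        z₀ + (a' + ⟦ P ⟧ (Σ[ x i ∈ γ ]))    ≡⟨ +-assoc z₀ a' (⟦ P ⟧ (Σ[ x i ∈ γ ])) ⟨
        z₀ + a' + ⟦ P ⟧ (Σ[ x i ∈ γ ])      ≡⟨ cong (λ v → z₀ + a' + ⟦ P ⟧ v) (Σ-blocks i f≗) ⟨
        z₀ + a' + ⟦ P ⟧ (Σ[ f ∈ blocks γ ]) ∎

    extension-step : ∀ i {f} → (∀ t → f t ≡ lookup F i t) → ∀ {n} (ch : Chain n) β → IsNEFin β → Below ch β F →
                     ∀ {P} → P ∈ S → (A ⋆) ((αSum r ch β + (z₀ + a')) + ⟦ P ⟧ (HSum r ch β + Σ[ f ∈ blocks γ ]))
    extension-step i {f} f≗ ch β β-finite below {P} P∈ =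
      subst (A ⋆) rearrange (C-absorbs (hit Q (increment∈polys P∈ (proj₂ (realised-range ρ))) i) ρ P∈)
      where
      open ≡-Reasoning
      u y X : ℕ
      u = αSum r ch β
      y = HSum r ch β
      X = Σ[ x i ∈ γ ]
      ρ : Realised u y
      ρ = realised ch β β-finite below refl refl
      Q : Poly
      Q = incrementPoly P y
      threshold≤y : threshold P ≤ y
      threshold≤y = ≤-trans (threshold≤L P∈) (realised-large ρ)
      1≤y : 1 ≤ y
      1≤y = ≤-trans (s≤s z≤n) (realised-large ρ)
      shuffle : ∀ u v z a q → u + v + (z + (a + q)) ≡ (u + (z + a)) + (q + v)
      shuffle = solve-∀
      rearrange : u + ⟦ P ⟧ y + (z₀ + (a' + ⟦ Q ⟧ X)) ≡ (u + (z₀ + a')) + ⟦ P ⟧ (y + Σ[ f ∈ blocks γ ])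
      rearrange = begin
        u + ⟦ P ⟧ y + (z₀ + (a' + ⟦ Q ⟧ X))   ≡⟨ shuffle u (⟦ P ⟧ y) z₀ a' (⟦ Q ⟧ X) ⟩
        (u + (z₀ + a')) + (⟦ Q ⟧ X + ⟦ P ⟧ y)  ≡⟨ cong (u + (z₀ + a') +_) (⟦incrementPoly⟧ P threshold≤y 1≤y X) ⟩
        (u + (z₀ + a')) + ⟦ P ⟧ (y + X)        ≡⟨ cong (λ v → u + (z₀ + a') + ⟦ P ⟧ (y + v)) (Σ-blocks i f≗) ⟨
        (u + (z₀ + a')) + ⟦ P ⟧ (y + Σ[ f ∈ blocks γ ]) ∎

    extension-admissible : Admissible r F extension
    extension-admissible = record
      { α-positive = ≤-trans (proj₂ (proj₂ z₀-pack)) (m≤m+n z₀ a')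
      ; H-finite   = blocks-nonempty (proj₁ γ-finite) , blocks-unique (proj₂ γ-finite)
      ; H-large    = length-blocks (proj₁ γ-finite)
      ; H-above    = λ G _ G⊊F s t s∈ t∈ → <-≤-trans (s≤s (H-bounded G⊊F s∈)) (∈blocks⇒≥ γ t∈)
      ; bound-base = λ f f∈ → ≤-trans (+-monoʳ-≤ (z₀ + a') (Σ≤Σ-F-max f∈)) (m≤m+n _ K)
      ; bound-step = λ G _ G⊊F f f∈ → +-mono-≤ (+-monoʳ-≤ (z₀ + a') (Σ≤Σ-F-max f∈)) (bound-bounded G⊊F)
      ; base∈A⋆    = λ f f∈ P P∈ → extension-base (proj₁ (∈ˢ⇒lookup f∈)) (proj₂ (∈ˢ⇒lookup f∈)) P∈
      ; step∈A⋆    = λ ch β β-finite below f f∈ P P∈ →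
          extension-step (proj₁ (∈ˢ⇒lookup f∈)) (proj₂ (∈ˢ⇒lookup f∈)) ch β β-finite below P∈
      }

  choose-admissible : ∀ {r F c} → Admissible r F c → Admissible r F (choose (Admissible r F))
  choose-admissible {r} {F} {c} adm =
    choose-spec (Admissible r F) B (lose (normalised∈candidates α<B bound<B H<B) normalised)
    where
    B : ℕ
    B = suc (α c ⊔ bound c ⊔ maxOf (λ s → s) (H c))

    H<B : ∀ {s} → s ∈ H c → s < B
    H<B s∈ = s≤s (≤-trans (∈⇒≤maxOf (λ s → s) s∈) (m≤n⊔m (α c ⊔ bound c) _))

    α<B : α c < B
    α<B = s≤s (≤-trans (m≤m⊔n (α c) (bound c)) (m≤m⊔n _ _))

    bound<B : bound c < B
    bound<B = s≤s (≤-trans (m≤n⊔m (α c) (bound c)) (m≤m⊔n _ _))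

    normalised : Admissible r F (code (α c) (normalise B (H c)) (bound c))
    normalised = Admissible-resupport (normalise-unique B (H c)) (normalise∼ H<B) adm

  -- codeAt k F is only meaningful for length F < k: the values on the proper subsets G of F
  -- are read off at restrict F G, which is shorter than F.
  codeAt : ℕ → SeqSet → Code
  codeAt zero    F = code 0 [] 0
  codeAt (suc k) F = choose (Admissible (λ G → codeAt k (restrict F G)) F)

  codeAt-resp : ∀ k k' {F F'} → F ≈ˢ F' → length F < k → length F' < k' → codeAt k F ≡ codeAt k' F'
  restrictions-agree : ∀ k k' {F F'} → F ≈ˢ F' → length F < suc k → length F' < suc k' →
                       ∀ G → Valid G → G ⊊ˢ F → codeAt k (restrict F G) ≡ codeAt k' (restrict F' G)

  codeAt-resp zero    _        _    ()   _
  codeAt-resp (suc k) zero     _    _    ()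
  codeAt-resp (suc k) (suc k') F≈F' |F|≤k |F'|≤k' = choose-cong λ c →
    mk⇔ (Admissible-transfer F≈F' (restrictions-agree k k' F≈F' |F|≤k |F'|≤k'))
        (Admissible-transfer (≈ˢ-sym F≈F') (restrictions-agree k' k (≈ˢ-sym F≈F') |F'|≤k' |F|≤k))

  restrictions-agree k k' {F} {F'} F≈F' |F|≤k |F'|≤k' G _ G⊊F =
    codeAt-resp k k' (≈ˢ-trans (restrict≈ˢ F G (proj₁ G⊊F)) (≈ˢ-sym (restrict≈ˢ F' G (proj₁ G⊊F'))))
                (≤-trans (restrict-shorter F G G⊊F) (≤-pred |F|≤k))
                (≤-trans (restrict-shorter F' G G⊊F') (≤-pred |F'|≤k'))
    where
    G⊊F' : G ⊊ˢ F'
    G⊊F' = ⊊ˢ-respʳ G⊊F F≈F'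

  codeOf : SeqSet → Code
  codeOf F = codeAt (suc (length F)) F

  codeOf-resp : ∀ {F F'} → F ≈ˢ F' → codeOf F ≡ codeOf F'
  codeOf-resp F≈F' = codeAt-resp _ _ F≈F' ≤-refl ≤-refl

  codeOf-admissible : mem p A → ∀ F → Valid F → Admissible codeOf F (codeOf F)
  codeOf-admissible A∈p F = admissible (suc (length F)) F ≤-refl
    where
    admissible : ∀ k F → length F < k → Valid F → Admissible codeOf F (codeOf F)
    admissible (suc k) F |F|≤k F-valid = Admissible-transfer ≈ˢ-refl r≡codeOf (choose-admissible new-admissible)
      where
      r : SeqSet → Code
      r G = codeAt (length F) (restrict F G)

      r≡codeOf : ∀ G → Valid G → G ⊊ˢ F → r G ≡ codeOf G
      r≡codeOf G _ G⊊F =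
        codeAt-resp (length F) (suc (length G)) (restrict≈ˢ F G (proj₁ G⊊F)) (restrict-shorter F G G⊊F) ≤-refl

      IH : ∀ G → Valid G → G ⊊ˢ F → Admissible codeOf G (codeOf G)
      IH G G-valid G⊊F =
        subst (Admissible codeOf G) (codeOf-resp R≈G)
          (Admissible-transfer R≈G (λ _ _ _ → refl)
            (admissible k R (≤-trans (restrict-shorter F G G⊊F) (≤-pred |F|≤k))
                            (restrict-valid F G F-valid G-valid (proj₁ G⊊F))))
        where
        R : SeqSet
        R = restrict F G
        R≈G : R ≈ˢ G
        R≈G = restrict≈ˢ F G (proj₁ G⊊F)

      new-admissible : Admissible r F (Step.extension A∈p codeOf codeOf-resp F F-valid IH)
      new-admissible = Admissible-transfer ≈ˢ-refl (λ G G-valid G⊊F → sym (r≡codeOf G G-valid G⊊F))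
                         (Step.extension-admissible A∈p codeOf codeOf-resp F F-valid IH)

theorem2p10 : (A : Subset) → (∀ n → A n → 1 ≤ n) → IsCp A → (S : List Poly) →
    Σ (SeqSet → ℕ) λ α → Σ (SeqSet → List ℕ) λ H →
    WellDefined α H × Cond1 H × Cond2 A S α H
theorem2p10 A _ (p , p-idem , p∈𝒥 , A∈p) S =
  (λ G → α (codeOf G)) , (λ G → H (codeOf G)) ,
  ((λ G G-valid → α-positive (admissible G G-valid) , H-finite (admissible G G-valid)) ,
   (λ F G _ _ F⊆G G⊆F → let same = codeOf-resp (F⊆G , G⊆F) in
      cong α same , λ t → subst (λ c → t ∈ H c) same , subst (λ c → t ∈ H c) (sym same))) ,
  (λ F G F-valid G-valid F⊊G → H-above (admissible G G-valid) F F-valid F⊊G) ,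
  (λ n G valid strict f f∈G β β-finite P P∈ →
     let ch = record { G = G ; valid = valid ; strict = strict ; f = f ; f∈G = f∈G }
     in proj₁ (ChainBounds.chain∈A⋆ codeOf ch β β-finite (λ _ → admissible _ (valid _)) P P∈))
  where
  open Construction A p p-idem p∈𝒥 S
  admissible : ∀ F → Valid F → Admissible codeOf F (codeOf F)
  admissible = codeOf-admissible A∈p
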